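{- Let $(\mathbf{V},\mathbf{C},F\dashv G)$ be a CLNL model in which the endofunctor $!=F\circ G$ on $\mathbf{C}$ is parametrically algebraically compact. Then $\mathbf{C}$ is a pointed category (it has a zero object), and for every object $A$ the zero morphism $I\to A$ equals $\perp_A:=\sigma_{\epsilon_A}\circ\gamma_I:I\to\Omega_I\to A$, where $\Omega_I$ is the carrier of the initial algebra of $I\otimes!(-)$ (equivalently, of $!$).
   Context: A CLNL model: a cartesian closed category $\mathbf{V}$ with finite coproducts (terminal $1$, product $\times$), a symmetric monoidal closed category $(\mathbf{C},\otimes,\multimap,I)$ with finite coproducts, and a symmetric monoidal adjunction $F\dashv G$, $F:\mathbf{V}\to\mathbf{C}$, with unit $\eta$ and counit $\epsilon:\,!\Rightarrow\mathrm{Id}$. An endofunctor $T$ is algebraically compact if it has an initial algebra $\omega:T(\Omega)\to\Omega$ such that $\omega^{ -1}:\Omega\to T(\Omega)$ is a final coalgebra; on a monoidal category, $T$ is parametrically algebraically compact if $A\otimes T(-)$ is algebraically compact for every object $A$. For an object $\Phi$ equipped with an isomorphism $\Phi\cong F(X)$, define $\Delta_\Phi:\Phi\cong F(X)\xrightarrow{F\langle\mathrm{id},\mathrm{id}\rangle}F(X\times X)\cong\Phi\otimes\Phi$ and $\mathbf{lift}_\Phi:\Phi\cong F(X)\xrightarrow{F(\eta_X)}\,!F(X)\cong\,!\Phi$. Let $\omega_\Phi:\Phi\otimes!\Omega_\Phi\to\Omega_\Phi$ be the initial algebra of $\Phi\otimes!(-)$. Then $\gamma_\Phi:\Phi\to\Omega_\Phi$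 is the unique coalgebra morphism (anamorphism) with $\omega_\Phi^{ -1}\circ\gamma_\Phi=(\mathrm{id}_\Phi\otimes!\gamma_\Phi)\circ(\mathrm{id}_\Phi\otimes\mathbf{lift}_\Phi)\circ\Delta_\Phi$, and for a morphism $m:\Phi\otimes!A\to A$, $\sigma_m:\Omega_\Phi\to A$ is the unique algebra morphism (catamorphism) with $\sigma_m\circ\omega_\Phi=m\circ(\mathrm{id}_\Phi\otimes!\sigma_m)$. Here $\Phi=I$ with $I\cong F(1)$, and $\epsilon_A$ is regarded as a morphism $I\otimes!A\to A$ via the left unitor. -}

module Defs where

open import Level using (Level; _⊔_) renaming (suc to lsuc)
open import Relation.Binary using (Rel; IsEquivalence)

record Category (o ℓ e : Level) : Set (lsuc (o ⊔ ℓ ⊔ e)) where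
  infixr 9 _∘_
  infix  4 _≈_ _⇒_
  field
    Obj : Set o
    _⇒_ : Obj → Obj → Set ℓ
    _≈_ : ∀ {A B} → Rel (A ⇒ B) e
    equiv : ∀ {A B} → IsEquivalence (_≈_ {A} {B})
    id  : ∀ {A} → A ⇒ A
    _∘_ : ∀ {A B C} → B ⇒ C → A ⇒ B → A ⇒ C
    assoc : ∀ {A B C D} {f : A ⇒ B} {g : B ⇒ C} {h : C ⇒ D} →
            (h ∘ g) ∘ f ≈ h ∘ (g ∘ f)
    identityˡ : ∀ {A B} {f : A ⇒ B} → id ∘ f ≈ f
    identityʳ : ∀ {A B} {f : A ⇒ B} → f ∘ id ≈ f
    ∘-resp-≈ : ∀ {A B C} {f h : B ⇒ C} {g i : A ⇒ B} →
               f ≈ h → g ≈ i → f ∘ g ≈ h ∘ i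

record Functor {o ℓ e o′ ℓ′ e′ : Level}
               (C : Category o ℓ e) (D : Category o′ ℓ′ e′)
               : Set (o ⊔ ℓ ⊔ e ⊔ o′ ⊔ ℓ′ ⊔ e′) where
  private
    module C = Category C
    module D = Category D
  field
    F₀ : C.Obj → D.Obj
    F₁ : ∀ {A B} → A C.⇒ B → F₀ A D.⇒ F₀ B
    identity : ∀ {A} → F₁ (C.id {A}) D.≈ D.id
    homomorphism : ∀ {X Y Z} {f : X C.⇒ Y} {g : Y C.⇒ Z} →
                   F₁ (g C.∘ f) D.≈ F₁ g D.∘ F₁ f
    F-resp-≈ : ∀ {A B} {f g : A C.⇒ B} → f C.≈ g → F₁ f D.≈ F₁ g

module Structures {o ℓ e : Level} (𝒞 : Category o ℓ e) where
  open Category 𝒞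

  record IsInitial (Z : Obj) : Set (o ⊔ ℓ ⊔ e) where
    field
      ¡ : ∀ {A} → Z ⇒ A
      ¡-unique : ∀ {A} (f : Z ⇒ A) → ¡ ≈ f

  record IsTerminal (Z : Obj) : Set (o ⊔ ℓ ⊔ e) where
    field
      ! : ∀ {A} → A ⇒ Z
      !-unique : ∀ {A} (f : A ⇒ Z) → ! ≈ f

  record IsZero (Z : Obj) : Set (o ⊔ ℓ ⊔ e) where
    field
      initial  : IsInitial Z
      terminal : IsTerminal Z

  zeroMorphism : ∀ {Z} → IsZero Z → ∀ {A B} → A ⇒ B
  zeroMorphism z = IsInitial.¡ (IsZero.initial z) ∘ IsTerminal.! (IsZero.terminal z)

  record Terminal : Set (o ⊔ ℓ ⊔ e) where
    field
      ⊤ : Obj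
      ⊤-isTerminal : IsTerminal ⊤

  record Initial : Set (o ⊔ ℓ ⊔ e) where
    field
      ⊥ : Obj
      ⊥-isInitial : IsInitial ⊥

  record BinaryProducts : Set (o ⊔ ℓ ⊔ e) where
    infixr 7 _×_
    field
      _×_ : Obj → Obj → Obj
      π₁ : ∀ {A B} → A × B ⇒ A
      π₂ : ∀ {A B} → A × B ⇒ B
      ⟨_,_⟩ : ∀ {X A B} → X ⇒ A → X ⇒ B → X ⇒ A × B
      project₁ : ∀ {X A B} {f : X ⇒ A} {g : X ⇒ B} → π₁ ∘ ⟨ f , g ⟩ ≈ f
      project₂ : ∀ {X A B} {f : X ⇒ A} {g : X ⇒ B} → π₂ ∘ ⟨ f , g ⟩ ≈ g
      unique : ∀ {X A B} {f : X ⇒ A} {g : X ⇒ B} {h : X ⇒ A × B} →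
               π₁ ∘ h ≈ f → π₂ ∘ h ≈ g → ⟨ f , g ⟩ ≈ h
    infixr 8 _⁂_
    _⁂_ : ∀ {A B C D} → A ⇒ B → C ⇒ D → A × C ⇒ B × D
    f ⁂ g = ⟨ f ∘ π₁ , g ∘ π₂ ⟩
    assocˣ : ∀ {A B C} → (A × B) × C ⇒ A × (B × C)
    assocˣ = ⟨ π₁ ∘ π₁ , ⟨ π₂ ∘ π₁ , π₂ ⟩ ⟩
    swapˣ : ∀ {A B} → A × B ⇒ B × A
    swapˣ = ⟨ π₂ , π₁ ⟩
    diag : ∀ {A} → A ⇒ A × A
    diag = ⟨ id , id ⟩

  record Exponentials (P : BinaryProducts) : Set (o ⊔ ℓ ⊔ e) where
    open BinaryProducts P
    infixr 7 _⇨_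
    field
      _⇨_ : Obj → Obj → Obj
      evalˣ : ∀ {B C} → (B ⇨ C) × B ⇒ C
      λg : ∀ {A B C} → A × B ⇒ C → A ⇒ B ⇨ C
      λ-β : ∀ {A B C} {f : A × B ⇒ C} → evalˣ ∘ (λg f ⁂ id) ≈ f
      λ-unique : ∀ {A B C} {f : A × B ⇒ C} {g : A ⇒ B ⇨ C} →
                 evalˣ ∘ (g ⁂ id) ≈ f → g ≈ λg f

  record CartesianClosed : Set (o ⊔ ℓ ⊔ e) where
    field
      terminal : Terminal
      products : BinaryProducts
      exponentials : Exponentials products

  record BinaryCoproducts : Set (o ⊔ ℓ ⊔ e) where
    infixr 6 _+_
    field
      _+_ : Obj → Obj → Obj
      i₁ : ∀ {A B} → A ⇒ A + B
      i₂ : ∀ {A B} → B ⇒ A + B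
      [_,_] : ∀ {A B X} → A ⇒ X → B ⇒ X → A + B ⇒ X
      inject₁ : ∀ {A B X} {f : A ⇒ X} {g : B ⇒ X} → [ f , g ] ∘ i₁ ≈ f
      inject₂ : ∀ {A B X} {f : A ⇒ X} {g : B ⇒ X} → [ f , g ] ∘ i₂ ≈ g
      unique : ∀ {A B X} {f : A ⇒ X} {g : B ⇒ X} {h : A + B ⇒ X} →
               h ∘ i₁ ≈ f → h ∘ i₂ ≈ g → [ f , g ] ≈ h

  record FiniteCoproducts : Set (o ⊔ ℓ ⊔ e) where
    field
      initial : Initial
      coproducts : BinaryCoproducts

  record Monoidal : Set (o ⊔ ℓ ⊔ e) where
    infixr 10 _⊗₀_ _⊗₁_
    field
      _⊗₀_ : Obj → Obj → Obj
      _⊗₁_ : ∀ {A B C D} → A ⇒ B → C ⇒ D → A ⊗₀ C ⇒ B ⊗₀ D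
      unit : Obj
      ⊗-identity : ∀ {A B} → id {A} ⊗₁ id {B} ≈ id
      ⊗-homomorphism : ∀ {A B C D E F} {f : A ⇒ B} {g : B ⇒ C} {h : D ⇒ E} {k : E ⇒ F} →
                       (g ∘ f) ⊗₁ (k ∘ h) ≈ (g ⊗₁ k) ∘ (f ⊗₁ h)
      ⊗-resp-≈ : ∀ {A B C D} {f f′ : A ⇒ B} {g g′ : C ⇒ D} →
                 f ≈ f′ → g ≈ g′ → f ⊗₁ g ≈ f′ ⊗₁ g′
      α⇒ : ∀ {A B C} → (A ⊗₀ B) ⊗₀ C ⇒ A ⊗₀ (B ⊗₀ C)
      α⇐ : ∀ {A B C} → A ⊗₀ (B ⊗₀ C) ⇒ (A ⊗₀ B) ⊗₀ C
      α-isoˡ : ∀ {A B C} → α⇐ ∘ α⇒ {A} {B} {C} ≈ id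
      α-isoʳ : ∀ {A B C} → α⇒ ∘ α⇐ {A} {B} {C} ≈ id
      α-natural : ∀ {A B C D E F} {f : A ⇒ B} {g : C ⇒ D} {h : E ⇒ F} →
                  α⇒ ∘ ((f ⊗₁ g) ⊗₁ h) ≈ (f ⊗₁ (g ⊗₁ h)) ∘ α⇒
      λ⇒ : ∀ {A} → unit ⊗₀ A ⇒ A
      λ⇐ : ∀ {A} → A ⇒ unit ⊗₀ A
      λ-isoˡ : ∀ {A} → λ⇐ ∘ λ⇒ {A} ≈ id
      λ-isoʳ : ∀ {A} → λ⇒ ∘ λ⇐ {A} ≈ id
      λ-natural : ∀ {A B} {f : A ⇒ B} → λ⇒ ∘ (id ⊗₁ f) ≈ f ∘ λ⇒
      ρ⇒ : ∀ {A} → A ⊗₀ unit ⇒ A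
      ρ⇐ : ∀ {A} → A ⇒ A ⊗₀ unit
      ρ-isoˡ : ∀ {A} → ρ⇐ ∘ ρ⇒ {A} ≈ id
      ρ-isoʳ : ∀ {A} → ρ⇒ ∘ ρ⇐ {A} ≈ id
      ρ-natural : ∀ {A B} {f : A ⇒ B} → ρ⇒ ∘ (f ⊗₁ id) ≈ f ∘ ρ⇒
      pentagon : ∀ {A B C D} →
                 (id {A} ⊗₁ α⇒ {B} {C} {D}) ∘ α⇒ ∘ (α⇒ ⊗₁ id) ≈ α⇒ ∘ α⇒
      triangle : ∀ {A B} → (id {A} ⊗₁ λ⇒ {B}) ∘ α⇒ ≈ ρ⇒ ⊗₁ id

  record Symmetric (M : Monoidal) : Set (o ⊔ ℓ ⊔ e) where
    open Monoidal M
    field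
      braid : ∀ {A B} → A ⊗₀ B ⇒ B ⊗₀ A
      braid-natural : ∀ {A B C D} {f : A ⇒ B} {g : C ⇒ D} →
                      braid ∘ (f ⊗₁ g) ≈ (g ⊗₁ f) ∘ braid
      commutative : ∀ {A B} → braid ∘ braid {A} {B} ≈ id
      hexagon : ∀ {A B C} →
                α⇒ ∘ braid ∘ α⇒ {A} {B} {C} ≈ (id ⊗₁ braid) ∘ α⇒ ∘ (braid ⊗₁ id)

  record Closed (M : Monoidal) : Set (o ⊔ ℓ ⊔ e) where
    open Monoidal M
    infixr 9 _⊸_
    field
      _⊸_ : Obj → Obj → Obj
      eval : ∀ {B C} → (B ⊸ C) ⊗₀ B ⇒ C
      curry : ∀ {A B C} → A ⊗₀ B ⇒ C → A ⇒ B ⊸ C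
      curry-β : ∀ {A B C} {f : A ⊗₀ B ⇒ C} → eval ∘ (curry f ⊗₁ id) ≈ f
      curry-unique : ∀ {A B C} {f : A ⊗₀ B ⇒ C} {g : A ⇒ B ⊸ C} →
                     eval ∘ (g ⊗₁ id) ≈ f → g ≈ curry f

  record SymmetricMonoidalClosed : Set (o ⊔ ℓ ⊔ e) where
    field
      monoidal : Monoidal
      symmetric : Symmetric monoidal
      closed : Closed monoidal

  -- T algebraically compact: initial T-algebra ω : T Ω → Ω whose inverse
  -- ω⁻¹ : Ω → T Ω is a final T-coalgebra.  The endofunctor is given by its
  -- object and morphism parts.
  record AlgebraicallyCompact (T₀ : Obj → Obj)
                              (T₁ : ∀ {A B} → A ⇒ B → T₀ A ⇒ T₀ B)
                              : Set (o ⊔ ℓ ⊔ e) where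
    field
      Ω : Obj
      ω : T₀ Ω ⇒ Ω
      fold : ∀ {A} → T₀ A ⇒ A → Ω ⇒ A
      fold-algebra : ∀ {A} (a : T₀ A ⇒ A) → fold a ∘ ω ≈ a ∘ T₁ (fold a)
      fold-unique : ∀ {A} (a : T₀ A ⇒ A) (h : Ω ⇒ A) →
                    h ∘ ω ≈ a ∘ T₁ h → h ≈ fold a
      ω⁻¹ : Ω ⇒ T₀ Ω
      ω-isoˡ : ω⁻¹ ∘ ω ≈ id
      ω-isoʳ : ω ∘ ω⁻¹ ≈ id
      unfold : ∀ {X} → X ⇒ T₀ X → X ⇒ Ω
      unfold-coalgebra : ∀ {X} (c : X ⇒ T₀ X) → ω⁻¹ ∘ unfold c ≈ T₁ (unfold c) ∘ c
      unfold-unique : ∀ {X} (c : X ⇒ T₀ X) (h : X ⇒ Ω) →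
                      ω⁻¹ ∘ h ≈ T₁ h ∘ c → h ≈ unfold c

module _ {o ℓ e o′ ℓ′ e′ : Level}
         (V : Category o ℓ e) (C : Category o′ ℓ′ e′) where
  private
    module V = Category V
    module C = Category C
    module SV = Structures V
    module SC = Structures C

  record SymmetricMonoidalAdjunction
           (VT : SV.Terminal) (VP : SV.BinaryProducts)
           (CM : SC.Monoidal) (CS : SC.Symmetric CM)
           (F : Functor V C) (G : Functor C V)
           : Set (o ⊔ ℓ ⊔ e ⊔ o′ ⊔ ℓ′ ⊔ e′) where
    open SV.Terminal VT
    open SV.BinaryProducts VP
    open SC.Monoidal CM
    open SC.Symmetric CS
    open Functor F renaming (F₀ to F₀; F₁ to F₁)
    open Functor G renaming (F₀ to G₀; F₁ to G₁) hiding (identity; homomorphism; F-resp-≈)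
    field
      φ₀ : unit C.⇒ F₀ ⊤
      φ₀⁻¹ : F₀ ⊤ C.⇒ unit
      φ₀-isoˡ : φ₀⁻¹ C.∘ φ₀ C.≈ C.id
      φ₀-isoʳ : φ₀ C.∘ φ₀⁻¹ C.≈ C.id
      φ : ∀ {A B} → F₀ A ⊗₀ F₀ B C.⇒ F₀ (A × B)
      φ⁻¹ : ∀ {A B} → F₀ (A × B) C.⇒ F₀ A ⊗₀ F₀ B
      φ-isoˡ : ∀ {A B} → φ⁻¹ C.∘ φ {A} {B} C.≈ C.id
      φ-isoʳ : ∀ {A B} → φ C.∘ φ⁻¹ {A} {B} C.≈ C.id
      φ-natural : ∀ {A B A′ B′} {f : A V.⇒ A′} {g : B V.⇒ B′} →
                  φ C.∘ (F₁ f ⊗₁ F₁ g) C.≈ F₁ (f ⁂ g) C.∘ φ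
      φ-assoc : ∀ {A B D} →
                F₁ assocˣ C.∘ φ {A × B} {D} C.∘ (φ ⊗₁ C.id)
                  C.≈ φ C.∘ (C.id ⊗₁ φ) C.∘ α⇒
      φ-unitˡ : ∀ {A} → F₁ π₂ C.∘ φ {⊤} {A} C.∘ (φ₀ ⊗₁ C.id) C.≈ λ⇒
      φ-unitʳ : ∀ {A} → F₁ π₁ C.∘ φ {A} {⊤} C.∘ (C.id ⊗₁ φ₀) C.≈ ρ⇒
      φ-braid : ∀ {A B} → F₁ swapˣ C.∘ φ {A} {B} C.≈ φ C.∘ braid
      ψ₀ : ⊤ V.⇒ G₀ unit
      ψ : ∀ {A B} → G₀ A × G₀ B V.⇒ G₀ (A ⊗₀ B)
      ψ-natural : ∀ {A B A′ B′} {f : A C.⇒ A′} {g : B C.⇒ B′} →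
                  ψ V.∘ (G₁ f ⁂ G₁ g) V.≈ G₁ (f ⊗₁ g) V.∘ ψ
      ψ-assoc : ∀ {A B D} →
                G₁ α⇒ V.∘ ψ {A ⊗₀ B} {D} V.∘ (ψ ⁂ V.id)
                  V.≈ ψ V.∘ (V.id ⁂ ψ) V.∘ assocˣ
      ψ-unitˡ : ∀ {A} → G₁ λ⇒ V.∘ ψ {unit} {A} V.∘ (ψ₀ ⁂ V.id) V.≈ π₂
      ψ-unitʳ : ∀ {A} → G₁ ρ⇒ V.∘ ψ {A} {unit} V.∘ (V.id ⁂ ψ₀) V.≈ π₁
      ψ-braid : ∀ {A B} → G₁ braid V.∘ ψ {A} {B} V.≈ ψ V.∘ swapˣ
      η : ∀ {X} → X V.⇒ G₀ (F₀ X)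
      ε : ∀ {A} → F₀ (G₀ A) C.⇒ A
      η-natural : ∀ {X Y} {f : X V.⇒ Y} → η V.∘ f V.≈ G₁ (F₁ f) V.∘ η
      ε-natural : ∀ {A B} {f : A C.⇒ B} → ε C.∘ F₁ (G₁ f) C.≈ f C.∘ ε
      zig : ∀ {X} → ε C.∘ F₁ (η {X}) C.≈ C.id
      zag : ∀ {A} → G₁ (ε {A}) V.∘ η V.≈ V.id
      η-monoidal₀ : η {⊤} V.≈ G₁ φ₀ V.∘ ψ₀
      η-monoidal : ∀ {X Y} → η {X × Y} V.≈ G₁ φ V.∘ ψ V.∘ (η ⁂ η)
      ε-monoidal₀ : ε C.∘ F₁ ψ₀ C.∘ φ₀ C.≈ C.id
      ε-monoidal : ∀ {A B} → ε {A ⊗₀ B} C.∘ F₁ ψ C.∘ φ C.≈ ε ⊗₁ ε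

record CLNLModel (o ℓ e o′ ℓ′ e′ : Level)
       : Set (lsuc (o ⊔ ℓ ⊔ e ⊔ o′ ⊔ ℓ′ ⊔ e′)) where
  field
    V : Category o ℓ e
    C : Category o′ ℓ′ e′
    V-cartesianClosed : Structures.CartesianClosed V
    V-coproducts : Structures.FiniteCoproducts V
    C-symmetricMonoidalClosed : Structures.SymmetricMonoidalClosed C
    C-coproducts : Structures.FiniteCoproducts C
    F : Functor V C
    G : Functor C V
    adjunction : SymmetricMonoidalAdjunction V C
                   (Structures.CartesianClosed.terminal V-cartesianClosed)
                   (Structures.CartesianClosed.products V-cartesianClosed)
                   (Structures.SymmetricMonoidalClosed.monoidal C-symmetricMonoidalClosed)
                   (Structures.SymmetricMonoidalClosed.symmetric C-symmetricMonoidalClosed)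
                   F G

  open Category C public using (Obj; _⇒_; _≈_; _∘_; id)
  open Structures C public using (IsZero; zeroMorphism; AlgebraicallyCompact)
  open Structures.Monoidal
         (Structures.SymmetricMonoidalClosed.monoidal C-symmetricMonoidalClosed)
         public using (_⊗₀_; _⊗₁_; unit; λ⇒)
  open Structures.Terminal (Structures.CartesianClosed.terminal V-cartesianClosed)
         using (⊤)
  open Structures.BinaryProducts (Structures.CartesianClosed.products V-cartesianClosed)
         using (diag)
  open SymmetricMonoidalAdjunction adjunction using (φ₀; φ₀⁻¹; φ⁻¹; η; ε)
  open Functor F renaming (F₀ to F₀; F₁ to F₁)
  open Functor G renaming (F₀ to G₀; F₁ to G₁) hiding (identity; homomorphism; F-resp-≈)

  !₀ : Obj → Obj
  !₀ A = F₀ (G₀ A)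

  !₁ : ∀ {A B} → A ⇒ B → !₀ A ⇒ !₀ B
  !₁ f = F₁ (G₁ f)

  ParametricallyAlgebraicallyCompact! : Set (o′ ⊔ ℓ′ ⊔ e′)
  ParametricallyAlgebraicallyCompact! =
    ∀ A → AlgebraicallyCompact (λ X → A ⊗₀ !₀ X) (λ f → id ⊗₁ !₁ f)

  module _ (pac : ParametricallyAlgebraicallyCompact!) where
    private
      module AC = AlgebraicallyCompact (pac unit)

    Ω_I : Obj
    Ω_I = AC.Ω

    Δ_I : unit ⇒ unit ⊗₀ unit
    Δ_I = (φ₀⁻¹ ⊗₁ φ₀⁻¹) ∘ φ⁻¹ ∘ F₁ (diag {⊤}) ∘ φ₀

    lift_I : unit ⇒ !₀ unit
    lift_I = !₁ φ₀⁻¹ ∘ F₁ (η {⊤}) ∘ φ₀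

    γ_I : unit ⇒ Ω_I
    γ_I = AC.unfold ((id ⊗₁ lift_I) ∘ Δ_I)

    σ : ∀ {A} → unit ⊗₀ !₀ A ⇒ A → Ω_I ⇒ A
    σ m = AC.fold m

    -- ⊥_A := σ_{ε_A} ∘ γ_I, with ε_A seen as I ⊗ !A → A via the left unitor
    ⊥[_] : ∀ A → unit ⇒ A
    ⊥[ A ] = σ (ε {A} ∘ λ⇒) ∘ γ_I

module Submission where

-- Let 0 be the initial object of C.  Since C is monoidal
-- closed, 0 ⊗ Y is again initial (- ⊗ Y is a left adjoint), and so is
-- I ⊗ 0 ≅ 0.  Parametric algebraic compactness supplies a point
-- ⊥₀ : I → 0, and in a monoidal closed category with an initial object a
-- single point I → 0 already makes 0 a zero object: every Y maps to 0 via
-- Y ≅ I ⊗ Y → 0 ⊗ Y → 0, and any h : Y → 0 equals this map because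
-- h ∘ λ = λ ∘ (I ⊗ h) is a map out of an initial object after sliding ⊥₀
-- past h.  For the formula, the zero morphism I → A is ¡_A ∘ ⊥₀ (maps into
-- the now terminal 0 are unique), and ¡_A ∘ σ_{ε₀} = σ_{ε_A} by fold
-- fusion: the family ε ∘ λ is natural, so ¡_A is a morphism of
-- I ⊗ !(-)-algebras.

open import Level using (Level)
open import Data.Product using (Σ; Σ-syntax; _,_)
open import Relation.Binary using (Setoid; IsEquivalence)
import Relation.Binary.Reasoning.Setoid as SetoidReasoning
open import Defs

module CategoryFacts {o ℓ e : Level} (𝒞 : Category o ℓ e) where
  open Category 𝒞
  open Structures 𝒞 using (IsInitial)

  hom : Obj → Obj → Setoid ℓ e
  hom A B = record { Carrier = A ⇒ B ; _≈_ = _≈_ ; isEquivalence = equiv }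

  module _ {A B : Obj} where
    open IsEquivalence (equiv {A} {B}) public using (refl; sym; trans)

  retraction-cancel : ∀ {X Y W} {r : Y ⇒ X} {s : X ⇒ Y} (f : X ⇒ W) →
                      r ∘ s ≈ id → (f ∘ r) ∘ s ≈ f
  retraction-cancel f rs≈id = trans assoc (trans (∘-resp-≈ refl rs≈id) identityʳ)

  initial-unique : ∀ {Z W} → IsInitial Z → (f g : Z ⇒ W) → f ≈ g
  initial-unique i f g = trans (sym (IsInitial.¡-unique i f)) (IsInitial.¡-unique i g)

  retract-of-initial : ∀ {X Z W} → IsInitial Z → (s : X ⇒ Z) (r : Z ⇒ X) →
                       r ∘ s ≈ id → (f g : X ⇒ W) → f ≈ g
  retract-of-initial i s r rs≈id f g =
    trans (sym (retraction-cancel f rs≈id))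
      (trans (∘-resp-≈ (initial-unique i (f ∘ r) (g ∘ r)) refl)
        (retraction-cancel g rs≈id))

module FoldFusion {o ℓ e : Level} (𝒞 : Category o ℓ e)
                  {T₀ : Category.Obj 𝒞 → Category.Obj 𝒞}
                  {T₁ : ∀ {A B} → Category._⇒_ 𝒞 A B → Category._⇒_ 𝒞 (T₀ A) (T₀ B)}
                  (T-homomorphism : ∀ {A B D} {f : Category._⇒_ 𝒞 A B}
                                      {g : Category._⇒_ 𝒞 B D} →
                                    Category._≈_ 𝒞 (T₁ (Category._∘_ 𝒞 g f))
                                      (Category._∘_ 𝒞 (T₁ g) (T₁ f)))
                  (AC : Structures.AlgebraicallyCompact 𝒞 T₀ T₁) where
  open Category 𝒞
  open CategoryFacts 𝒞
  open Structures.AlgebraicallyCompact AC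

  fold-fusion : ∀ {A B} {a : T₀ A ⇒ A} {b : T₀ B ⇒ B} (h : A ⇒ B) →
                h ∘ a ≈ b ∘ T₁ h → h ∘ fold a ≈ fold b
  fold-fusion {a = a} {b} h h-algebra-morphism = fold-unique b (h ∘ fold a) (begin
      (h ∘ fold a) ∘ ω             ≈⟨ assoc ⟩
      h ∘ (fold a ∘ ω)             ≈⟨ ∘-resp-≈ refl (fold-algebra a) ⟩
      h ∘ (a ∘ T₁ (fold a))        ≈⟨ sym assoc ⟩
      (h ∘ a) ∘ T₁ (fold a)        ≈⟨ ∘-resp-≈ h-algebra-morphism refl ⟩
      (b ∘ T₁ h) ∘ T₁ (fold a)     ≈⟨ assoc ⟩
      b ∘ (T₁ h ∘ T₁ (fold a))     ≈⟨ ∘-resp-≈ refl (sym T-homomorphism) ⟩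
      b ∘ T₁ (h ∘ fold a)          ∎)
    where open SetoidReasoning (hom _ _)

module MonoidalClosedFacts {o ℓ e : Level} (𝒞 : Category o ℓ e)
                           (M : Structures.Monoidal 𝒞)
                           (Cl : Structures.Closed 𝒞 M)
                           {Z : Category.Obj 𝒞}
                           (Z-initial : Structures.IsInitial 𝒞 Z) where
  open Category 𝒞
  open CategoryFacts 𝒞
  open Structures 𝒞 using (IsZero; IsInitial)
  open Structures.Monoidal M
  open Structures.Closed Cl

  ⊗-interchange : ∀ {A B C D} {f : A ⇒ B} {g : C ⇒ D} →
                  (f ⊗₁ id) ∘ (id ⊗₁ g) ≈ (id ⊗₁ g) ∘ (f ⊗₁ id)
  ⊗-interchange = trans (sym ⊗-homomorphism)
    (trans (⊗-resp-≈ (trans identityʳ (sym identityˡ)) (trans identityˡ (sym identityʳ)))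
      ⊗-homomorphism)

  -- 0 ⊗ Y is initial: maps 0 ⊗ Y → W correspond to maps 0 → Y ⊸ W.
  ⊗-initial : ∀ {Y W} (f g : Z ⊗₀ Y ⇒ W) → f ≈ g
  ⊗-initial f g = trans (sym curry-β)
    (trans (∘-resp-≈ refl (⊗-resp-≈ (initial-unique Z-initial (curry f) (curry g)) refl))
      curry-β)

  unit⊗-initial : ∀ {W} (f g : unit ⊗₀ Z ⇒ W) → f ≈ g
  unit⊗-initial = retract-of-initial Z-initial λ⇒ λ⇐ λ-isoˡ

  collapse : ∀ {Y} → Z ⊗₀ Y ⇒ Z
  collapse = eval ∘ (IsInitial.¡ Z-initial ⊗₁ id)

  module _ (p : unit ⇒ Z) where
    into-initial : ∀ {Y} (h : Y ⇒ Z) → h ∘ λ⇒ ≈ collapse ∘ (p ⊗₁ id)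
    into-initial h = begin
        h ∘ λ⇒                               ≈⟨ sym λ-natural ⟩
        λ⇒ ∘ (id ⊗₁ h)                       ≈⟨ ∘-resp-≈ (unit⊗-initial _ _) refl ⟩
        (collapse ∘ (p ⊗₁ id)) ∘ (id ⊗₁ h)   ≈⟨ assoc ⟩
        collapse ∘ ((p ⊗₁ id) ∘ (id ⊗₁ h))   ≈⟨ ∘-resp-≈ refl ⊗-interchange ⟩
        collapse ∘ ((id ⊗₁ h) ∘ (p ⊗₁ id))   ≈⟨ sym assoc ⟩
        (collapse ∘ (id ⊗₁ h)) ∘ (p ⊗₁ id)   ≈⟨ ∘-resp-≈ (⊗-initial _ _) refl ⟩
        collapse ∘ (p ⊗₁ id)                 ∎
      where open SetoidReasoning (hom _ _)

    pointed-initial-isZero : IsZero Z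
    pointed-initial-isZero = record
      { initial  = Z-initial
      ; terminal = record
        { !        = (collapse ∘ (p ⊗₁ id)) ∘ λ⇐
        ; !-unique = λ h → trans (∘-resp-≈ (sym (into-initial h)) refl)
                                 (retraction-cancel h λ-isoʳ)
        }
      }

module CLNLFacts {o ℓ e o′ ℓ′ e′ : Level} (M : CLNLModel o ℓ e o′ ℓ′ e′) where
  open CLNLModel M
  open Category C using (assoc; identityˡ; ∘-resp-≈)
  open CategoryFacts C
  open Structures.Monoidal (Structures.SymmetricMonoidalClosed.monoidal C-symmetricMonoidalClosed)
    using (λ-natural; ⊗-homomorphism; ⊗-resp-≈)
  open SymmetricMonoidalAdjunction adjunction using (ε; ε-natural)
  module F = Functor F
  module G = Functor G

  unit⊗!-homomorphism : ∀ {A B D} {f : A ⇒ B} {g : B ⇒ D} →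
                        id ⊗₁ !₁ (g ∘ f) ≈ (id ⊗₁ !₁ g) ∘ (id {unit} ⊗₁ !₁ f)
  unit⊗!-homomorphism = trans (⊗-resp-≈ (sym identityˡ)
                                  (trans (F.F-resp-≈ G.homomorphism) F.homomorphism))
                              ⊗-homomorphism

  ελ-natural : ∀ {A B} (f : A ⇒ B) → f ∘ (ε ∘ λ⇒) ≈ (ε ∘ λ⇒) ∘ (id ⊗₁ !₁ f)
  ελ-natural f = begin
      f ∘ (ε ∘ λ⇒)               ≈⟨ sym assoc ⟩
      (f ∘ ε) ∘ λ⇒               ≈⟨ ∘-resp-≈ (sym ε-natural) refl ⟩
      (ε ∘ !₁ f) ∘ λ⇒            ≈⟨ assoc ⟩
      ε ∘ (!₁ f ∘ λ⇒)            ≈⟨ ∘-resp-≈ refl (sym λ-natural) ⟩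
      ε ∘ (λ⇒ ∘ (id ⊗₁ !₁ f))    ≈⟨ sym assoc ⟩
      (ε ∘ λ⇒) ∘ (id ⊗₁ !₁ f)    ∎
    where open SetoidReasoning (hom _ _)

  ⊥-natural : (pac : ParametricallyAlgebraicallyCompact!) →
              ∀ {A B} (f : A ⇒ B) → f ∘ ⊥[_] pac A ≈ ⊥[_] pac B
  ⊥-natural pac f =
    trans (sym assoc)
      (∘-resp-≈ (FoldFusion.fold-fusion C unit⊗!-homomorphism (pac unit) f (ελ-natural f))
                refl)

mainTheorem6 : ∀ {o ℓ e o′ ℓ′ e′} (M : CLNLModel o ℓ e o′ ℓ′ e′) →
    let open CLNLModel M in
    (pac : ParametricallyAlgebraicallyCompact!) →
    Σ[ Z ∈ Obj ] Σ[ z ∈ IsZero Z ]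
    (∀ A → zeroMorphism z {unit} {A} ≈ ⊥[_] pac A)
mainTheorem6 M pac = 0C , isZero , zero≈⊥
  where
    open CLNLModel M
    open CategoryFacts C
    open Structures.Initial (Structures.FiniteCoproducts.initial C-coproducts)
      renaming (⊥ to 0C; ⊥-isInitial to 0C-initial)
    open MonoidalClosedFacts C
      (Structures.SymmetricMonoidalClosed.monoidal C-symmetricMonoidalClosed)
      (Structures.SymmetricMonoidalClosed.closed C-symmetricMonoidalClosed)
      0C-initial

    isZero : IsZero 0C
    isZero = pointed-initial-isZero (⊥[_] pac 0C)

    -- zero morphism = ¡_A ∘ (I → 0) = ¡_A ∘ ⊥₀ = ⊥_A
    zero≈⊥ : ∀ A → zeroMorphism isZero {unit} {A} ≈ ⊥[_] pac A
    zero≈⊥ A = trans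
      (Category.∘-resp-≈ C refl
        (Structures.IsTerminal.!-unique (Structures.IsZero.terminal isZero) (⊥[_] pac 0C)))
      (CLNLFacts.⊥-natural M pac (Structures.IsInitial.¡ 0C-initial))
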